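{- Let $A$ be a finite set, $R\subseteq A^k$ a relation with $k\ge2$, and $i\in\{1,\dots,k\}$. Define $c_{R,i}:A^{k-1}\to(\mathbb{N}_0,\cdot)$ by $c_{R,i}(a_1,\dots,a_{k-1})=|\{x\in A\mid(a_1,\dots,a_{i-1},x,a_i,\dots,a_{k-1})\in R\}|$. Then $\mathrm{Pol}(w_R)\subseteq\mathrm{Pol}(c_{R,i})$.
   Context: $(\mathbb{N}_0,\cdot)$ is the monoid of nonnegative integers under multiplication. $B_n(A)=\mathrm{Sym}(A^n)$, $B(A)=\bigcup_n B_n(A)$. For a weight map $w:A^k\to(M,\cdot)$ into a commutative monoid, $f\in B_n(A)$ respects $w$ if for every $k\times n$ array $a$ over $A$, the product of $w$ over the columns of $a$ equals the product of $w$ over the columns of $f(a)$, the array obtained by applying $f$ to each row of $a$; $\mathrm{Pol}(w)$ is the set of all $f\in B(A)$ respecting $w$. $w_R:A^k\to(\{0,1\},\wedge)$ is the characteristic function of $R$. -}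

module Defs where

open import Level using (Level)
open import Data.Nat using (ℕ; suc)
open import Data.Bool using (Bool)
open import Data.Fin using (Fin)
open import Data.Vec using (Vec; map; transpose; insertAt; allFin; countᵇ)
open import Algebra.Bundles using (CommutativeMonoid)
open import Function.Bundles using (_⤖_; Bijection)

module _ {c ℓ : Level} (M : CommutativeMonoid c ℓ) where
  open CommutativeMonoid M

  prod : {n : ℕ} → Vec Carrier n → Carrier
  prod Vec.[] = ε
  prod (x Vec.∷ xs) = x ∙ prod xs

  Respects : {A : Set} {k n : ℕ} → (Vec A k → Carrier) → (Vec A n → Vec A n) → Set ℓ
  Respects {A} {k} {n} w f =
    (a : Vec (Vec A n) k) → prod (map w (transpose a)) ≈ prod (map w (transpose (map f a)))

-- Pol(w) ⊆ Pol(w'): every f ∈ B(A) = ⋃ₙ Sym(Aⁿ) respecting w also respects w'.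
-- Weight maps may have different arities k, k'.
PolSubset : {c ℓ c' ℓ' : Level} {A : Set} {k k' : ℕ}
  (M : CommutativeMonoid c ℓ) (w : Vec A k → CommutativeMonoid.Carrier M)
  (M' : CommutativeMonoid c' ℓ') (w' : Vec A k' → CommutativeMonoid.Carrier M') →
  Set (ℓ Level.⊔ ℓ')
PolSubset {A = A} M w M' w' =
  (n : ℕ) (f : Vec A n ⤖ Vec A n) →
  Respects M w (Bijection.to f) → Respects M' w' (Bijection.to f)

-- A finite set A is taken to be Fin m; a relation R ⊆ A^k is given by its
-- characteristic function R : A^k → Bool, so w_R = R viewed in ({0,1},∧).
wR : {m k : ℕ} → (Vec (Fin m) k → Bool) → Vec (Fin m) k → Bool
wR R = R

cR : {m j : ℕ} → (Vec (Fin m) (suc j) → Bool) → Fin (suc j) → Vec (Fin m) j → ℕ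
cR {m} R i a = countᵇ (λ x → R (insertAt a i x)) (allFin m)

{-# OPTIONS --safe #-}
-- Write A = Fin m and let b be a (k−1)×n array. Choosing x ∈ Aⁿ as the missing row i,
-- the product over the columns of c_{R,i} is the number of x ∈ Aⁿ such that every
-- column of the completed k×n array lies in R. A permutation f of Aⁿ respecting w_R
-- maps the completions of b bijectively (x ↦ f x) onto the completions of f(b), so
-- both products of c_{R,i} agree.
module Submission where

open import Defs
open import Data.Nat using (ℕ; zero; suc; _≤_; _+_; _*_; _^_)
open import Data.Nat.Properties
  using (*-1-commutativeMonoid; +-0-commutativeMonoid; +-*-semiring; +-identityʳ)
open import Data.Bool using (Bool; true; false; _∧_)
open import Data.Bool.Properties using (∧-commutativeMonoid)
import Data.Fin as F
open F using (Fin; _↑ˡ_; _↑ʳ_; combine; finToFun; funToFin)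
open import Data.Fin.Properties using (remQuot-combine; finToFun-funToFin; funToFin-finToFin)
open import Data.Fin.Permutation using (Permutation′)
open import Data.Product using (_,_)
open import Data.Vec using (Vec; []; _∷_; map; head; tail; lookup; tabulate; insertAt; transpose; countᵇ)
open import Data.Vec.Properties using (tabulate-cong; tabulate∘lookup; lookup∘tabulate; map-insertAt)
open import Data.Vec.Functional using (Vector)
open import Algebra.Bundles using (Monoid; CommutativeMonoid)
open import Function using (_∘_; id; _↔_; _⤖_; Inverse; mk↔ₛ′)
open import Function.Bundles using (Bijection)
open import Function.Properties.Bijection using (⤖⇒↔)
open import Function.Properties.Inverse using (↔-sym)
open import Function.Construct.Composition using (_↔-∘_)
open import Relation.Binary.PropositionalEquality
  using (_≡_; refl; sym; trans; cong; cong₂; _≗_; module ≡-Reasoning)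

module _ {c ℓ} (M : Monoid c ℓ) where
  open Monoid M using (Carrier; _≈_; _∙_; ∙-congˡ; identityˡ; assoc)
    renaming (refl to ≈-refl; sym to ≈-sym; trans to ≈-trans)
  open import Algebra.Properties.Monoid.Sum M using (sum)

  sum-↑ : ∀ p {q} (t : Vector Carrier (p + q)) →
    sum t ≈ sum {p} (t ∘ (_↑ˡ q)) ∙ sum {q} (t ∘ (p ↑ʳ_))
  sum-↑ zero    t = ≈-sym (identityˡ _)
  sum-↑ (suc p) t = ≈-trans (∙-congˡ (sum-↑ p (t ∘ F.suc))) (≈-sym (assoc _ _ _))

  sum-combine : ∀ p q (t : Vector Carrier (p * q)) →
    sum t ≈ sum {p} (λ x → sum {q} (λ y → t (combine x y)))
  sum-combine zero    q t = ≈-refl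
  sum-combine (suc p) q t = ≈-trans (sum-↑ q t) (∙-congˡ (sum-combine p q (t ∘ (q ↑ʳ_))))

funToFin-cong : ∀ {m n} {f g : Fin m → Fin n} → f ≗ g → funToFin f ≡ funToFin g
funToFin-cong {zero}  f≗g = refl
funToFin-cong {suc m} f≗g = cong₂ combine (f≗g F.zero) (funToFin-cong (f≗g ∘ F.suc))

module _ {m : ℕ} where
  open ≡-Reasoning

  Vec↔Fin^ : ∀ n → Vec (Fin m) n ↔ Fin (m ^ n)
  Vec↔Fin^ n = mk↔ₛ′ toFin fromFin toFin∘fromFin fromFin∘toFin
    where
    toFin : Vec (Fin m) n → Fin (m ^ n)
    toFin = funToFin ∘ lookup
    fromFin : Fin (m ^ n) → Vec (Fin m) n
    fromFin = tabulate ∘ finToFun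
    toFin∘fromFin : ∀ k → toFin (fromFin k) ≡ k
    toFin∘fromFin k = begin
      toFin (fromFin k)              ≡⟨ funToFin-cong {n} (lookup∘tabulate (finToFun k)) ⟩
      funToFin (finToFun {m} {n} k)  ≡⟨ funToFin-finToFin {n} k ⟩
      k                              ∎
    fromFin∘toFin : ∀ v → fromFin (toFin v) ≡ v
    fromFin∘toFin v = begin
      fromFin (toFin v)    ≡⟨ tabulate-cong (finToFun-funToFin (lookup v)) ⟩
      tabulate (lookup v)  ≡⟨ tabulate∘lookup v ⟩
      v                    ∎

  tabulate-finToFun-combine : ∀ {n} (x : Fin m) (k : Fin (m ^ n)) →
    tabulate (finToFun {m} {suc n} (combine x k)) ≡ x ∷ tabulate (finToFun k)
  tabulate-finToFun-combine {n} x k =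
    cong (λ { (y , l) → y ∷ tabulate (finToFun l) }) (remQuot-combine {k = m ^ n} x k)

module SumOverVec {c ℓ} (M : CommutativeMonoid c ℓ) {m : ℕ} where
  open CommutativeMonoid M using (Carrier; _≈_; monoid; reflexive) renaming (trans to ≈-trans)
  open import Algebra.Properties.CommutativeMonoid.Sum M using (sum; sum-permute; sum-cong-≗)

  sumᵛ : ∀ n → (Vec (Fin m) n → Carrier) → Carrier
  sumᵛ n g = sum (g ∘ Inverse.from (Vec↔Fin^ n))

  sumᵛ-∷ : ∀ n (g : Vec (Fin m) (suc n) → Carrier) →
    sumᵛ (suc n) g ≈ sum (λ x → sumᵛ n (g ∘ (x ∷_)))
  sumᵛ-∷ n g = ≈-trans (sum-combine monoid m (m ^ n) _)
    (reflexive (sum-cong-≗ (λ x → sum-cong-≗ (λ k → cong g (tabulate-finToFun-combine x k)))))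

  sumᵛ-⤖ : ∀ n (f : Vec (Fin m) n ⤖ Vec (Fin m) n) (g : Vec (Fin m) n → Carrier) →
    sumᵛ n g ≈ sumᵛ n (g ∘ Bijection.to f)
  sumᵛ-⤖ n f g = ≈-trans (sum-permute {m ^ n} _ π)
    (reflexive (sum-cong-≗ {m ^ n} (λ k → cong g (Inverse.strictlyInverseʳ e _))))
    where
    e : Vec (Fin m) n ↔ Fin (m ^ n)
    e = Vec↔Fin^ n
    π : Permutation′ (m ^ n)
    π = e ↔-∘ (⤖⇒↔ f ↔-∘ ↔-sym e)

open import Algebra.Properties.Semiring.Sum +-*-semiring
  using (sum; sum-cong-≗; *-distribˡ-sum; *-distribʳ-sum)
open SumOverVec +-0-commutativeMonoid

boolToℕ : Bool → ℕ
boolToℕ true  = 1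
boolToℕ false = 0

boolToℕ-∧ : ∀ a b → boolToℕ (a ∧ b) ≡ boolToℕ a * boolToℕ b
boolToℕ-∧ true  b = sym (+-identityʳ (boolToℕ b))
boolToℕ-∧ false b = refl

countᵇ-tabulate : ∀ {A : Set} {m} (P : A → Bool) (h : Fin m → A) →
  countᵇ P (tabulate h) ≡ sum (boolToℕ ∘ P ∘ h)
countᵇ-tabulate {m = zero}  P h = refl
countᵇ-tabulate {m = suc m} P h with P (h F.zero)
... | true  = cong suc (countᵇ-tabulate P (h ∘ F.suc))
... | false = countᵇ-tabulate P (h ∘ F.suc)

transpose-∷ : ∀ {A : Set} {n r} (b : Vec (Vec A (suc n)) r) →
  transpose b ≡ map head b ∷ transpose (map tail b)
transpose-∷ []             = refl
transpose-∷ ((x ∷ xs) ∷ b) rewrite transpose-∷ b = refl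

transpose-insertAt-∷ : ∀ {A : Set} {n r} (b : Vec (Vec A (suc n)) r) (i : Fin (suc r)) x v →
  transpose (insertAt b i (x ∷ v)) ≡ insertAt (map head b) i x ∷ transpose (insertAt (map tail b) i v)
transpose-insertAt-∷ b i x v =
  trans (transpose-∷ (insertAt b i (x ∷ v)))
        (cong₂ (λ c t → c ∷ transpose t) (map-insertAt head (x ∷ v) b i) (map-insertAt tail (x ∷ v) b i))

module _ {m j : ℕ} (R : Vec (Fin m) (suc j) → Bool) (i : Fin (suc j)) where
  open ≡-Reasoning

  columnsInR : ∀ {n} → Vec (Vec (Fin m) n) (suc j) → Bool
  columnsInR a = prod ∧-commutativeMonoid (map R (transpose a))

  #completions : ∀ {n} → Vec (Vec (Fin m) n) j → ℕ
  #completions {n} b = sumᵛ n (λ x → boolToℕ (columnsInR (insertAt b i x)))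

  prod-cR≡#completions : ∀ n (b : Vec (Vec (Fin m) n) j) →
    prod *-1-commutativeMonoid (map (cR R i) (transpose b)) ≡ #completions b
  prod-cR≡#completions zero b with transpose b | transpose (insertAt b i [])
  ... | [] | [] = refl
  prod-cR≡#completions (suc n) b = begin
    prod *-1-commutativeMonoid (map (cR R i) (transpose b))
      ≡⟨ cong (prod *-1-commutativeMonoid ∘ map (cR R i)) (transpose-∷ b) ⟩
    cR R i (map head b) * prod *-1-commutativeMonoid (map (cR R i) (transpose (map tail b)))
      ≡⟨ cong₂ _*_ (countᵇ-tabulate (λ x → R (insertAt (map head b) i x)) id)
                   (prod-cR≡#completions n (map tail b)) ⟩
    sum inR * #completions (map tail b)
      ≡⟨ *-distribʳ-sum (#completions (map tail b)) inR ⟩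
    sum (λ x → inR x * #completions (map tail b))
      ≡⟨ sum-cong-≗ {m} (λ x → *-distribˡ-sum {m ^ n} (inR x) _) ⟩
    sum (λ x → sumᵛ n (λ v → inR x * boolToℕ (columnsInR (insertAt (map tail b) i v))))
      ≡⟨ sum-cong-≗ {m} (λ x → sum-cong-≗ {m ^ n} (λ k → sym (completion-∷ x _))) ⟩
    sum (λ x → sumᵛ n (λ v → boolToℕ (columnsInR (insertAt b i (x ∷ v)))))
      ≡⟨ sumᵛ-∷ n (λ x → boolToℕ (columnsInR (insertAt b i x))) ⟨
    #completions b ∎
    where
    inR : Fin m → ℕ
    inR x = boolToℕ (R (insertAt (map head b) i x))
    completion-∷ : ∀ x v → boolToℕ (columnsInR (insertAt b i (x ∷ v)))
                         ≡ inR x * boolToℕ (columnsInR (insertAt (map tail b) i v))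
    completion-∷ x v = trans (cong (boolToℕ ∘ prod ∧-commutativeMonoid ∘ map R) (transpose-insertAt-∷ b i x v))
                             (boolToℕ-∧ (R (insertAt (map head b) i x)) _)

  #completions-⤖ : ∀ {n} (f : Vec (Fin m) n ⤖ Vec (Fin m) n) →
    Respects ∧-commutativeMonoid R (Bijection.to f) →
    (b : Vec (Vec (Fin m) n) j) → #completions b ≡ #completions (map (Bijection.to f) b)
  #completions-⤖ {n} f respects b = begin
    #completions b
      ≡⟨ sum-cong-≗ {m ^ n} (λ k → cong boolToℕ (completion-to _)) ⟩
    sumᵛ n (λ x → boolToℕ (columnsInR (insertAt (map to b) i (to x))))
      ≡⟨ sumᵛ-⤖ n f (λ y → boolToℕ (columnsInR (insertAt (map to b) i y))) ⟨
    #completions (map to b) ∎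
    where
    open Bijection f using (to)
    completion-to : ∀ x → columnsInR (insertAt b i x) ≡ columnsInR (insertAt (map to b) i (to x))
    completion-to x = trans (respects (insertAt b i x)) (cong columnsInR (map-insertAt to x b i))

lemma13 : (m j : ℕ) → 2 ≤ suc j → (R : Vec (Fin m) (suc j) → Bool) → (i : Fin (suc j)) →
    PolSubset ∧-commutativeMonoid (wR R) *-1-commutativeMonoid (cR R i)
lemma13 m j _ R i n f respects b = begin
  prod *-1-commutativeMonoid (map (cR R i) (transpose b))           ≡⟨ prod-cR≡#completions R i n b ⟩
  #completions R i b                                                ≡⟨ #completions-⤖ R i f respects b ⟩
  #completions R i (map (Bijection.to f) b)                         ≡⟨ prod-cR≡#completions R i n _ ⟨
  prod *-1-commutativeMonoid (map (cR R i) (transpose (map (Bijection.to f) b))) ∎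
  where open ≡-Reasoning
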